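{- The schema $(\mathrm{A_{S3}})$: $(\epsilon ab\wedge\epsilon bc)\supset(\epsilon bb\wedge(\epsilon cd\supset(\epsilon ad\wedge\epsilon ba)))$ is nontrivial with respect to $(\mathrm{A_{t-1}})$: $(\epsilon ab\wedge\epsilon bc)\supset(\epsilon ac\wedge\epsilon ba)$.
   Context: Formulas are built from atomic formulas $\epsilon xy$ ($x,y$ name variables) with classical connectives; schemata treat name variables as meta-variables. A formula is an instance of a tautology if it is a tautology when distinct atomic formulas $\epsilon xy$ are treated as distinct propositional atoms. $nv(A)$ is the tuple of distinct name variables occurring in $A$ in order of first occurrence from the left. Definition: a schema $A$ with $nv(A)=(x_1,\dots,x_n)$, $n\ge3$, is trivial with respect to $(\mathrm{A_{t-1}})$ if there exist a permutation $\rho$ of $\{1,\dots,n\}$ and mutually distinct name variables $y_1,\dots,y_{n-3}$, none among $x_1,\dots,x_n$ or $a,b,c$, such that for the uniform substitution $\sigma$ replacing $x_{\rho(1)},x_{\rho(2)},x_{\rho(3)}$ simultaneously by $a,b,c$ and $x_{\rho(3+j)}$ by $y_j$, the formula $\sigma(A)\equiv(\mathrm{A_{t-1}})$ is an instance of a tautology; nontrivial means not trivial. -}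

module Defs where

open import Data.Nat using (ℕ; zero; suc; _+_; _≡ᵇ_)
open import Data.Nat.Properties using (_≟_)
open import Data.Empty using (⊥)
open import Data.Bool using (Bool; true; false; if_then_else_; not; _∧_; _∨_)
open import Data.List using (List; []; _∷_; _++_; deduplicate)
open import Data.List.Membership.Propositional using (_∉_)
open import Data.List.Relation.Unary.All using (All)
open import Data.List.Relation.Unary.Unique.Propositional using (Unique)
open import Data.Vec using (Vec; []; _∷_; lookup; toList)
open import Data.Fin using (Fin; zero; suc)
open import Data.Fin.Permutation using (Permutation′; _⟨$⟩ˡ_)
open import Data.Product using (Σ; Σ-syntax; _×_)
open import Relation.Binary.PropositionalEquality using (_≡_)

Name : Set
Name = ℕ

-- Formulas of the pure (propositional) language of Leśniewski's Ontology.
data Formula : Set where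
  ε    : Name → Name → Formula
  ¬′   : Formula → Formula
  _∧′_ : Formula → Formula → Formula
  _∨′_ : Formula → Formula → Formula
  _⊃_  : Formula → Formula → Formula
  _≡′_ : Formula → Formula → Formula

infixr 6 _∧′_
infixr 5 _∨′_
infixr 4 _⊃_
infix  3 _≡′_

-- Classical truth value, where each atomic formula ε x y is an independent
-- propositional atom (valuation on pairs of names).
eval : (Name → Name → Bool) → Formula → Bool
eval v (ε x y)   = v x y
eval v (¬′ A)    = not (eval v A)
eval v (A ∧′ B)  = eval v A ∧ eval v B
eval v (A ∨′ B)  = eval v A ∨ eval v B
eval v (A ⊃ B)   = not (eval v A) ∨ eval v B
eval v (A ≡′ B)  = if eval v A then eval v B else not (eval v B)

InstanceOfTautology : Formula → Set
InstanceOfTautology A = (v : Name → Name → Bool) → eval v A ≡ true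

names : Formula → List Name
names (ε x y)  = x ∷ y ∷ []
names (¬′ A)   = names A
names (A ∧′ B) = names A ++ names B
names (A ∨′ B) = names A ++ names B
names (A ⊃ B)  = names A ++ names B
names (A ≡′ B) = names A ++ names B

nv : Formula → List Name
nv A = deduplicate _≟_ (names A)

subst : (Name → Name) → Formula → Formula
subst f (ε x y)  = ε (f x) (f y)
subst f (¬′ A)   = ¬′ (subst f A)
subst f (A ∧′ B) = subst f A ∧′ subst f B
subst f (A ∨′ B) = subst f A ∨′ subst f B
subst f (A ⊃ B)  = subst f A ⊃ subst f B
subst f (A ≡′ B) = subst f A ≡′ subst f B

-- Simultaneous substitution x_i ↦ t i for the listed variables x_0,…,x_{n-1}
-- (assumed distinct); other names are left unchanged.
simul : ∀ {n} → Vec Name n → (Fin n → Name) → Name → Name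
simul []       t z = z
simul (x ∷ xs) t z = if x ≡ᵇ z then t zero else simul xs (λ i → t (suc i)) z

a b c d : Name
a = 0
b = 1
c = 2
d = 3

At1 : Formula
At1 = (ε a b ∧′ ε b c) ⊃ (ε a c ∧′ ε b a)

AS3 : Formula
AS3 = (ε a b ∧′ ε b c) ⊃ (ε b b ∧′ (ε c d ⊃ (ε a d ∧′ ε b a)))

-- Triviality w.r.t. (A_{t-1}).  nv(A) = (x_1,…,x_n) with n = 3 + m ≥ 3;
-- ρ a permutation; y_1,…,y_m mutually distinct, not among nv(A) nor a,b,c;
-- σ(x_{ρ(k)}) = (a,b,c,y_1,…,y_m)_k, i.e. σ(x_i) = t (ρ⁻¹ i).
TrivialWrtAt1 : Formula → Set
TrivialWrtAt1 A =
  Σ[ m ∈ ℕ ] Σ[ xs ∈ Vec Name (3 + m) ] (toList xs ≡ nv A) ×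
  (Σ[ ρ ∈ Permutation′ (3 + m) ] Σ[ ys ∈ Vec Name m ]
     Unique (toList ys) ×
     All (λ y → y ∉ nv A × y ∉ (a ∷ b ∷ c ∷ [])) (toList ys) ×
     InstanceOfTautology
       (subst (simul xs (λ i → lookup (a ∷ b ∷ c ∷ ys) (ρ ⟨$⟩ˡ i))) A ≡′ At1))

NontrivialWrtAt1 : Formula → Set
NontrivialWrtAt1 A = TrivialWrtAt1 A → ⊥

-- Make ε x y true exactly when x and y are distinct names.  Under this
-- valuation (A_{t-1}) is true whatever a, b, c denote, while any
-- substitution instance of (A_{S3}) that keeps a, b apart and b, c apart is
-- false: its antecedent holds but the conjunct ε b b fails.  The
-- substitutions allowed by the definition of triviality send a, b, c to the
-- images of three distinct names under an injective map, so none of them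
-- can turn (A_{S3}) ≡ (A_{t-1}) into an instance of a tautology.
module Submission where

open import Defs
open import Data.Bool using (Bool; true; false; not)
open import Data.Empty using (⊥-elim)
open import Data.Fin using (Fin; zero; suc)
open import Data.Fin.Permutation using (Permutation′; _⟨$⟩ˡ_; flip)
open import Data.List using (List; []; _∷_; _++_)
open import Data.List.Membership.Propositional using (_∉_)
open import Data.List.Relation.Unary.All as All using (All; _∷_)
open import Data.List.Relation.Unary.Unique.Propositional using (Unique; _∷_)
open import Data.List.Relation.Unary.Unique.Propositional.Properties using (++⁺)
open import Data.List.Relation.Unary.Unique.DecPropositional using (unique?)
open import Data.Nat.Properties using (_≟_)
open import Data.Product using (_,_; proj₂)
open import Data.Vec using (Vec; []; _∷_; lookup; toList)
open import Data.Vec.Membership.Propositional.Properties using (∈-lookup; ∈-toList⁺)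
open import Function using (_∘_)
open import Function.Bundles using (Injection)
open import Function.Properties.Inverse using (Inverse⇒Injection)
open import Relation.Binary.PropositionalEquality using (_≡_; _≢_; refl; sym; trans; cong)
open import Relation.Nullary using (¬_; does)
open import Relation.Nullary.Decidable using (dec-true; dec-false; toWitness)

lookup-injective : ∀ {A : Set} {n} (v : Vec A n) → Unique (toList v) →
                   ∀ {i j} → lookup v i ≡ lookup v j → i ≡ j
lookup-injective (_ ∷ _) _ {zero} {zero} _ = refl
lookup-injective (x ∷ xs) (x∉xs ∷ _) {zero} {suc j} x≡xsⱼ =
  ⊥-elim (All.lookup x∉xs (∈-toList⁺ (∈-lookup j xs)) x≡xsⱼ)
lookup-injective (x ∷ xs) (x∉xs ∷ _) {suc i} {zero} xsᵢ≡x =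
  ⊥-elim (All.lookup x∉xs (∈-toList⁺ (∈-lookup i xs)) (sym xsᵢ≡x))
lookup-injective (x ∷ xs) (_ ∷ xs-unique) {suc i} {suc j} xsᵢ≡xsⱼ =
  cong suc (lookup-injective xs xs-unique xsᵢ≡xsⱼ)

unique-++-fresh : ∀ {A : Set} {xs ys : List A} → Unique xs → Unique ys →
                  All (_∉ xs) ys → Unique (xs ++ ys)
unique-++-fresh xs-unique ys-unique ys-fresh =
  ++⁺ xs-unique ys-unique (λ (v∈xs , v∈ys) → All.lookup ys-fresh v∈ys v∈xs)

permutation-from-injective : ∀ {n} (ρ : Permutation′ n) {i j} →
                             ρ ⟨$⟩ˡ i ≡ ρ ⟨$⟩ˡ j → i ≡ j
permutation-from-injective ρ = Injection.injective (Inverse⇒Injection (flip ρ))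

distinct : Name → Name → Bool
distinct x y = not (does (x ≟ y))

distinct-≢ : ∀ {x y} → x ≢ y → distinct x y ≡ true
distinct-≢ {x} {y} x≢y rewrite dec-false (x ≟ y) x≢y = refl

distinct-refl : ∀ x → distinct x x ≡ false
distinct-refl x rewrite dec-true (x ≟ x) refl = refl

At1-true-on-distinct : eval distinct At1 ≡ true
At1-true-on-distinct = refl

AS3-instance-false-on-distinct : ∀ f → f a ≢ f b → f b ≢ f c →
                                 eval distinct (subst f AS3) ≡ false
AS3-instance-false-on-distinct f fa≢fb fb≢fc
  rewrite distinct-≢ fa≢fb | distinct-≢ fb≢fc | distinct-refl (f b) = refl

≡′-false : ∀ v {A B} → eval v A ≡ false → eval v B ≡ true → eval v (A ≡′ B) ≡ false
≡′-false v A-false B-true rewrite A-false | B-true = refl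

≡′-not-tautology : ∀ v {A B} → eval v A ≡ false → eval v B ≡ true →
                   ¬ InstanceOfTautology (A ≡′ B)
≡′-not-tautology v {A} {B} A-false B-true taut
  with () ← trans (sym (taut v)) (≡′-false v {A} {B} A-false B-true)

proposition5p1 : NontrivialWrtAt1 AS3
-- nv(A_{S3}) computes to (a, b, c, d), which fixes m = 1 and the vector xs.
proposition5p1 (_ , 0 ∷ 1 ∷ 2 ∷ 3 ∷ [] , refl , ρ , ys , ys-unique , ys-fresh , taut) =
  ≡′-not-tautology distinct {subst σ AS3} {At1}
    (AS3-instance-false-on-distinct σ ((λ ()) ∘ ρ-injective) ((λ ()) ∘ ρ-injective))
    At1-true-on-distinct taut
  where
  abc-ys : Vec Name 4
  abc-ys = a ∷ b ∷ c ∷ ys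

  abc-ys-unique : Unique (toList abc-ys)
  abc-ys-unique = unique-++-fresh (toWitness {a? = unique? _≟_ (a ∷ b ∷ c ∷ [])} _)
                    ys-unique (All.map proj₂ ys-fresh)

  ρ-image : Fin 4 → Name
  ρ-image i = lookup abc-ys (ρ ⟨$⟩ˡ i)

  ρ-injective : ∀ {i j} → ρ-image i ≡ ρ-image j → i ≡ j
  ρ-injective = permutation-from-injective ρ ∘ lookup-injective abc-ys abc-ys-unique

  σ : Name → Name
  σ = simul (a ∷ b ∷ c ∷ d ∷ []) ρ-image
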